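{- Let $n\ge 1$ and let $[a_1,\ldots,a_n]\in\tilde S_n$. Then for every $1\le i\le n$, $$a_i=i-\sum_{i<p\le n}\left\lfloor\frac{a_p-a_i}{n}\right\rfloor+\sum_{1\le p<i}\left\lfloor\frac{a_i-a_p}{n}\right\rfloor.$$
   Context: The affine symmetric group $\tilde S_n$ is the group of bijections $f:\mathbb Z\to\mathbb Z$ with $f(x+n)=f(x)+n$ for all $x$ and $f(1)+\cdots+f(n)=n(n+1)/2$; $f$ is identified with its window $[f(1),\ldots,f(n)]$, i.e. $a_i=f(i)$. -}

module Defs where

open import Data.Nat as ℕ using (ℕ; zero; suc)
open import Data.Integer using (ℤ; +_; _+_; _-_; _/ℕ_)
open import Function.Definitions using (Bijective)
open import Relation.Binary.PropositionalEquality using (_≡_)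
open import Data.Product using (_×_)

∑ : ℕ → (ℕ → ℤ) → ℤ
∑ zero    g = + 0
∑ (suc m) g = ∑ m g + g (suc m)

-- Sum of g p over lo < p ≤ hi (empty when hi ≤ lo):
-- g (lo+1) + ... + g hi.
∑-range : ℕ → ℕ → (ℕ → ℤ) → ℤ
∑-range lo hi g = ∑ (hi ℕ.∸ lo) (λ k → g (lo ℕ.+ k))

-- Floor of x / n for n ≥ 1 (stdlib's _/ℕ_ is floor division for
-- a positive natural divisor).
⌊_/_⌋ : ℤ → (n : ℕ) → .{{ℕ.NonZero n}} → ℤ
⌊ x / n ⌋ = x /ℕ n

record IsAffinePerm (n : ℕ) (f : ℤ → ℤ) : Set where
  field
    bijective : Bijective _≡_ _≡_ f
    periodic  : ∀ x → f (x + + n) ≡ f x + + n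
    windowSum : ∑ n (λ i → f (+ i)) ≡ + ((n ℕ.* suc n) ℕ./ 2)

module Submission where

-- Fix x = f i and write x - f p = r p + q p * n with 0 ≤ r p < n. Since f is a bijection
-- commuting with translation by n, the residues r 1, ..., r n are 0, ..., n - 1 in some
-- order; summing the decompositions and using the window sum n(n+1)/2 gives
-- q 1 + ... + q n = x - n. Now q i = 0, the floor terms with p < i are q p, and for p > i
-- the residue r p is nonzero, so ⌊(f p - x)/n⌋ = - q p - 1. The right-hand side is
-- therefore i + (n - i) + (q 1 + ... + q n) = x.

open import Defs
open import Data.Nat as ℕ using (ℕ; zero; suc; _≤_; z≤n; s≤s)
open import Data.Integer as ℤ using (ℤ; +_; _+_; _-_; -_; _*_; _/ℕ_; _%ℕ_; -[1+_]) renaming (suc to sucℤ)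
open import Relation.Binary.PropositionalEquality
  using (_≡_; _≢_; refl; sym; trans; cong; cong₂; subst; subst₂; module ≡-Reasoning)

import Data.Nat.Properties as ℕ
import Data.Nat.DivMod as ℕ
open import Data.Nat.Divisibility using (divides-refl)
open import Data.Integer.Properties
open import Data.Integer.DivMod using (a≡a%ℕn+[a/ℕn]*n; n%ℕd<d; [n/ℕd]*d≤n; n<s[n/ℕd]*d)
open import Data.Integer.Tactic.RingSolver using (solve-∀)
import Data.Nat.Tactic.RingSolver as ℕ
open import Algebra.Properties.AbelianGroup +-0-abelianGroup using (∙-cancelˡ; ∙-cancelʳ)
import Algebra.Properties.CommutativeMonoid.Sum +-0-commutativeMonoid as Fin
open import Data.Fin using (Fin; toℕ; fromℕ; fromℕ<; inject₁)
open import Data.Fin.Properties using (toℕ-fromℕ; toℕ-fromℕ<; toℕ-inject₁; toℕ-injective; toℕ<n)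
open import Data.Fin.Permutation using (Permutation; permutation; _⟨$⟩ʳ_)
open import Data.Product using (_×_; _,_; proj₁; proj₂; ∃)

∑-cong : ∀ m {g h : ℕ → ℤ} → (∀ k → 1 ≤ k → k ≤ m → g k ≡ h k) → ∑ m g ≡ ∑ m h
∑-cong zero    g≗h = refl
∑-cong (suc m) g≗h =
  cong₂ _+_ (∑-cong m (λ k 1≤k k≤m → g≗h k 1≤k (ℕ.m≤n⇒m≤1+n k≤m)))
            (g≗h (suc m) (s≤s z≤n) ℕ.≤-refl)

∑-distrib-+ : ∀ m (g h : ℕ → ℤ) → ∑ m (λ k → g k + h k) ≡ ∑ m g + ∑ m h
∑-distrib-+ zero    g h = refl
∑-distrib-+ (suc m) g h =
  trans (cong (_+ (g (suc m) + h (suc m))) (∑-distrib-+ m g h))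
        (+-interchange (∑ m g) (∑ m h) (g (suc m)) (h (suc m)))
  where +-interchange : ∀ a b c d → (a + b) + (c + d) ≡ (a + c) + (b + d)
        +-interchange = solve-∀

∑-neg : ∀ m (g : ℕ → ℤ) → ∑ m (λ k → - g k) ≡ - ∑ m g
∑-neg zero    g = refl
∑-neg (suc m) g = trans (cong (_+ - g (suc m)) (∑-neg m g)) (sym (neg-distrib-+ (∑ m g) (g (suc m))))

∑-const : ∀ m c → ∑ m (λ _ → c) ≡ + m * c
∑-const zero    c = sym (*-zeroˡ c)
∑-const (suc m) c = begin
  ∑ m (λ _ → c) + c ≡⟨ cong (_+ c) (∑-const m c) ⟩
  + m * c + c       ≡⟨ +-comm (+ m * c) c ⟩
  c + + m * c       ≡⟨ sym (suc-* (+ m) c) ⟩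
  + suc m * c       ∎
  where open ≡-Reasoning

*-distribˡ-∑ : ∀ m c (g : ℕ → ℤ) → ∑ m (λ k → c * g k) ≡ c * ∑ m g
*-distribˡ-∑ zero    c g = sym (*-zeroʳ c)
*-distribˡ-∑ (suc m) c g =
  trans (cong (_+ c * g (suc m)) (*-distribˡ-∑ m c g)) (sym (*-distribˡ-+ c (∑ m g) (g (suc m))))

∑-append : ∀ a b (g : ℕ → ℤ) → ∑ (a ℕ.+ b) g ≡ ∑ a g + ∑ b (λ k → g (a ℕ.+ k))
∑-append a zero    g rewrite ℕ.+-identityʳ a = sym (+-identityʳ (∑ a g))
∑-append a (suc b) g rewrite ℕ.+-suc a b =
  trans (cong (_+ g (suc (a ℕ.+ b))) (∑-append a b g)) (+-assoc (∑ a g) _ _)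

∑-split : ∀ {i m} (g : ℕ → ℤ) → i ℕ.≤ m → ∑ m g ≡ ∑ i g + ∑-range i m g
∑-split {i} {m} g i≤m = trans (cong (λ l → ∑ l g) (sym (ℕ.m+[n∸m]≡n i≤m))) (∑-append i (m ℕ.∸ i) g)

∑≡sum : ∀ m (g : ℕ → ℤ) → ∑ m g ≡ Fin.sum (λ (k : Fin m) → g (suc (toℕ k)))
∑≡sum zero    g = refl
∑≡sum (suc m) g = sym (begin
  Fin.sum (λ (k : Fin (suc m)) → g (suc (toℕ k)))
    ≡⟨ Fin.sum-init-last {m} (λ k → g (suc (toℕ k))) ⟩
  Fin.sum (λ (k : Fin m) → g (suc (toℕ (inject₁ k)))) + g (suc (toℕ (fromℕ m)))
    ≡⟨ cong₂ _+_ (Fin.sum-cong-≗ {m} (λ k → cong g′ (toℕ-inject₁ k))) (cong g′ (toℕ-fromℕ m)) ⟩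
  Fin.sum (λ (k : Fin m) → g (suc (toℕ k))) + g (suc m)
    ≡⟨ cong (_+ g (suc m)) (∑≡sum m g) ⟨
  ∑ m g + g (suc m) ∎)
  where
  open ≡-Reasoning
  g′ : ℕ → ℤ
  g′ j = g (suc j)

∑-id : ∀ m → ∑ m (λ k → + k) ≡ + (m ℕ.* suc m ℕ./ 2)
∑-id zero    = refl
∑-id (suc m) = trans (cong (_+ + suc m) (∑-id m)) (cong +_ (begin
  m ℕ.* suc m ℕ./ 2 ℕ.+ suc m
    ≡⟨ cong (m ℕ.* suc m ℕ./ 2 ℕ.+_) (ℕ.m*n/n≡m (suc m) 2) ⟨
  m ℕ.* suc m ℕ./ 2 ℕ.+ suc m ℕ.* 2 ℕ./ 2
    ≡⟨ ℕ.+-distrib-/-∣ʳ (m ℕ.* suc m) (divides-refl (suc m)) ⟨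
  (m ℕ.* suc m ℕ.+ suc m ℕ.* 2) ℕ./ 2
    ≡⟨ cong (ℕ._/ 2) (triangle-step m) ⟩
  suc m ℕ.* suc (suc m) ℕ./ 2 ∎))
  where
  open ≡-Reasoning
  triangle-step : ∀ m → m ℕ.* suc m ℕ.+ suc m ℕ.* 2 ≡ suc m ℕ.* suc (suc m)
  triangle-step = ℕ.solve-∀

2*∑-id : ∀ m → + 2 * ∑ m (λ k → + k) ≡ + m * (+ m + + 1)
2*∑-id zero    = refl
2*∑-id (suc m) = begin
  + 2 * (∑ m (λ k → + k) + + suc m)          ≡⟨ *-distribˡ-+ (+ 2) (∑ m (λ k → + k)) (+ suc m) ⟩
  + 2 * ∑ m (λ k → + k) + + 2 * + suc m       ≡⟨ cong (_+ + 2 * + suc m) (2*∑-id m) ⟩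
  + m * (+ m + + 1) + + 2 * (+ 1 + + m)       ≡⟨ step (+ m) ⟩
  + suc m * (+ suc m + + 1)                   ∎
  where
  open ≡-Reasoning
  step : ∀ a → a * (a + + 1) + + 2 * (+ 1 + a) ≡ (+ 1 + a) * ((+ 1 + a) + + 1)
  step = solve-∀

pos-∸ : ∀ {m n} → n ℕ.≤ m → + (m ℕ.∸ n) ≡ + m - + n
pos-∸ {m} {n} n≤m = sym (trans (m-n≡m⊖n m n) (⊖-≥ n≤m))

/ℕ-unique : ∀ {n} .{{_ : ℕ.NonZero n}} {x q} → q * + n ℤ.≤ x → x ℤ.< sucℤ q * + n → x /ℕ n ≡ q
/ℕ-unique {n} {x} lower upper =
  ≤-antisym (below-next ([n/ℕd]*d≤n x n) upper) (below-next lower (n<s[n/ℕd]*d x n))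
  where
  below-next : ∀ {a b} → a * + n ℤ.≤ x → x ℤ.< sucℤ b * + n → a ℤ.≤ b
  below-next {b = b} a*n≤x x<[1+b]*n =
    subst (_ ℤ.≤_) (pred-suc b)
          (i<j⇒i≤pred[j] (*-cancelʳ-<-nonNeg {j = sucℤ b} (+ n) (≤-<-trans a*n≤x x<[1+b]*n)))

divMod-unique : ∀ {n} .{{_ : ℕ.NonZero n}} {x q r} → r ℕ.< n → x ≡ + r + q * + n →
                x /ℕ n ≡ q × x %ℕ n ≡ r
divMod-unique {n} {x} {q} {r} r<n x≡r+qn = x/n≡q , +-injective (∙-cancelʳ (q * + n) _ _ (begin
  + (x %ℕ n) + q * + n        ≡⟨ cong (λ q′ → + (x %ℕ n) + q′ * + n) x/n≡q ⟨
  + (x %ℕ n) + x /ℕ n * + n   ≡⟨ a≡a%ℕn+[a/ℕn]*n x n ⟨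
  x                           ≡⟨ x≡r+qn ⟩
  + r + q * + n               ∎))
  where
  open ≡-Reasoning
  x/n≡q : x /ℕ n ≡ q
  x/n≡q = /ℕ-unique (subst (q * + n ℤ.≤_) (sym x≡r+qn) (i≤j+i (q * + n) (+ r)))
                    (subst₂ ℤ._<_ (sym x≡r+qn) (sym (suc-* q (+ n))) (+-monoˡ-< (q * + n) (ℤ.+<+ r<n)))

≡-mod-<⇒≡ : ∀ {n} .{{_ : ℕ.NonZero n}} {a b} k → a ℕ.< n → b ℕ.< n → + a ≡ + b + k * + n → a ≡ b
≡-mod-<⇒≡ {a = a} k a<n b<n a≡b+kn =
  trans (sym (ℕ.m<n⇒m%n≡m {m = a} a<n)) (proj₂ (divMod-unique {q = k} b<n a≡b+kn))

neg-/ℕ : ∀ {n} .{{_ : ℕ.NonZero n}} x → x %ℕ n ≢ 0 → (- x) /ℕ n ≡ - (x /ℕ n + + 1)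
neg-/ℕ {n} x r≢0 = proj₁ (divMod-unique (ℕ.∸-monoʳ-< (ℕ.n≢0⇒n>0 r≢0) (ℕ.<⇒≤ r<n)) (begin
  - x                              ≡⟨ cong -_ (a≡a%ℕn+[a/ℕn]*n x n) ⟩
  - (+ r + q * + n)                ≡⟨ reflect (+ r) q (+ n) ⟩
  (+ n - + r) + - (q + + 1) * + n  ≡⟨ cong (_+ - (q + + 1) * + n) (pos-∸ (ℕ.<⇒≤ r<n)) ⟨
  + (n ℕ.∸ r) + - (q + + 1) * + n  ∎))
  where
  open ≡-Reasoning
  r = x %ℕ n
  q = x /ℕ n
  r<n : r ℕ.< n
  r<n = n%ℕd<d x n
  reflect : ∀ r q n → - (r + q * n) ≡ (n - r) + - (q + + 1) * n
  reflect = solve-∀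

module _ {n : ℕ} (f : ℤ → ℤ) (periodic : ∀ x → f (x + + n) ≡ f x + + n) where

  periodic-ℕ : ∀ x m → f (x + + m * + n) ≡ f x + + m * + n
  periodic-ℕ x zero    = trans (cong f (+-identityʳ x)) (sym (+-identityʳ (f x)))
  periodic-ℕ x (suc m) = begin
    f (x + + suc m * + n)         ≡⟨ cong f (shift x) ⟩
    f ((x + + m * + n) + + n)     ≡⟨ periodic (x + + m * + n) ⟩
    f (x + + m * + n) + + n       ≡⟨ cong (_+ + n) (periodic-ℕ x m) ⟩
    (f x + + m * + n) + + n       ≡⟨ shift (f x) ⟨
    f x + + suc m * + n           ∎
    where
    open ≡-Reasoning
    shift : ∀ y → y + + suc m * + n ≡ (y + + m * + n) + + n
    shift y = trans (cong (λ z → y + z) (suc-* (+ m) (+ n))) (swap y (+ n) (+ m * + n))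
      where swap : ∀ a b c → a + (b + c) ≡ (a + c) + b
            swap = solve-∀

  periodic-* : ∀ x k → f (x + k * + n) ≡ f x + k * + n
  periodic-* x (+ m)        = periodic-ℕ x m
  periodic-* x k@(-[1+ m ]) = begin
    f (x + k * + n)                             ≡⟨ cancel-+- (f (x + k * + n)) k (+ n) ⟨
    (f (x + k * + n) + - k * + n) + k * + n     ≡⟨ cong (_+ k * + n) (periodic-ℕ (x + k * + n) (suc m)) ⟨
    f ((x + k * + n) + - k * + n) + k * + n     ≡⟨ cong (λ y → f y + k * + n) (cancel-+- x (- k) (+ n)) ⟩
    f x + k * + n                               ∎
    where
    open ≡-Reasoning
    cancel-+- : ∀ y k n → (y + - k * n) + k * n ≡ y
    cancel-+- = solve-∀

module _ {n : ℕ} .{{_ : ℕ.NonZero n}} {f : ℤ → ℤ} (affine : IsAffinePerm n f) where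
  open IsAffinePerm affine

  -- Window positions 1, ..., n are written suc a with a < n.
  window-≡-mod⇒≡ : ∀ {a b} k → a ℕ.< n → b ℕ.< n → f (+ suc a) ≡ f (+ suc b) + k * + n → a ≡ b
  window-≡-mod⇒≡ {a} {b} k a<n b<n fa≡fb+kn =
    ≡-mod-<⇒≡ k a<n b<n
      (∙-cancelˡ (+ 1) (+ a) (+ b + k * + n) (trans 1+a≡1+b+kn (+-assoc (+ 1) (+ b) (k * + n))))
    where
    1+a≡1+b+kn : + suc a ≡ + suc b + k * + n
    1+a≡1+b+kn = proj₁ bijective (trans fa≡fb+kn (sym (periodic-* f periodic (+ suc b) k)))

  module Residues (x : ℤ) where

    quotient : ℕ → ℤ
    quotient p = (x - f (+ p)) /ℕ n

    residue : ℕ → ℕ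
    residue p = (x - f (+ p)) %ℕ n

    residue<n : ∀ p → residue p ℕ.< n
    residue<n p = n%ℕd<d (x - f (+ p)) n

    f≡x-residue-quotient : ∀ p → f (+ p) ≡ x - (+ residue p + quotient p * + n)
    f≡x-residue-quotient p =
      trans (x-[x-y]≡y x (f (+ p))) (cong (λ z → x - z) (a≡a%ℕn+[a/ℕn]*n (x - f (+ p)) n))
      where x-[x-y]≡y : ∀ x y → y ≡ x - (x - y)
            x-[x-y]≡y = solve-∀

    residue-injective : ∀ {a b} → a ℕ.< n → b ℕ.< n → residue (suc a) ≡ residue (suc b) → a ≡ b
    residue-injective {a} {b} a<n b<n ra≡rb = window-≡-mod⇒≡ (qb - qa) a<n b<n (begin
      f (+ suc a)
        ≡⟨ f≡x-residue-quotient (suc a) ⟩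
      x - (+ residue (suc a) + qa * + n)
        ≡⟨ cong (λ r → x - (+ r + qa * + n)) ra≡rb ⟩
      x - (+ residue (suc b) + qa * + n)
        ≡⟨ shift x (+ residue (suc b)) qa qb (+ n) ⟩
      (x - (+ residue (suc b) + qb * + n)) + (qb - qa) * + n
        ≡⟨ cong (_+ (qb - qa) * + n) (f≡x-residue-quotient (suc b)) ⟨
      f (+ suc b) + (qb - qa) * + n ∎)
      where
      open ≡-Reasoning
      qa = quotient (suc a)
      qb = quotient (suc b)
      shift : ∀ x r qa qb n → x - (r + qa * n) ≡ (x - (r + qb * n)) + (qb - qa) * n
      shift = solve-∀

    residue-surjective : ∀ {j} → j ℕ.< n → ∃ λ a → a ℕ.< n × residue (suc a) ≡ j
    residue-surjective {j} j<n = a , n%ℕd<d (y - + 1) n , proj₂ (divMod-unique {q = m} j<n (begin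
      x - f (+ suc a)                  ≡⟨ cong (λ z → x - z) (f[1+a]≡x-j-mn) ⟩
      x - ((x - + j) - m * + n)        ≡⟨ unshift x (+ j) (m * + n) ⟩
      + j + m * + n                    ∎))
      where
      open ≡-Reasoning
      y = proj₁ (proj₂ bijective (x - + j))
      a = (y - + 1) %ℕ n
      m = (y - + 1) /ℕ n
      y≡1+a+mn : y ≡ + suc a + m * + n
      y≡1+a+mn = begin
        y                          ≡⟨ y≡1+[y-1] y ⟩
        + 1 + (y - + 1)            ≡⟨ cong (λ z → + 1 + z) (a≡a%ℕn+[a/ℕn]*n (y - + 1) n) ⟩
        + 1 + (+ a + m * + n)      ≡⟨ +-assoc (+ 1) (+ a) (m * + n) ⟨
        + suc a + m * + n          ∎
        where y≡1+[y-1] : ∀ y → y ≡ + 1 + (y - + 1)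
              y≡1+[y-1] = solve-∀
      f[1+a]≡x-j-mn : f (+ suc a) ≡ (x - + j) - m * + n
      f[1+a]≡x-j-mn = begin
        f (+ suc a)                          ≡⟨ z≡[z+w]-w (f (+ suc a)) (m * + n) ⟩
        (f (+ suc a) + m * + n) - m * + n    ≡⟨ cong (_- m * + n) (periodic-* f periodic (+ suc a) m) ⟨
        f (+ suc a + m * + n) - m * + n      ≡⟨ cong (λ z → f z - m * + n) y≡1+a+mn ⟨
        f y - m * + n                        ≡⟨ cong (_- m * + n) (proj₂ (proj₂ bijective (x - + j)) refl) ⟩
        (x - + j) - m * + n                  ∎
        where z≡[z+w]-w : ∀ z w → z ≡ (z + w) - w
              z≡[z+w]-w = solve-∀
      unshift : ∀ x j mn → x - ((x - j) - mn) ≡ j + mn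
      unshift = solve-∀

    residue-permutation : Permutation n n
    residue-permutation = permutation to from to∘from from∘to
      where
      to : Fin n → Fin n
      to k = fromℕ< (residue<n (suc (toℕ k)))
      from : Fin n → Fin n
      from j = fromℕ< (proj₁ (proj₂ (residue-surjective (toℕ<n j))))
      to∘from : ∀ j → to (from j) ≡ j
      to∘from j = toℕ-injective (begin
        toℕ (to (from j))            ≡⟨ toℕ-fromℕ< _ ⟩
        residue (suc (toℕ (from j))) ≡⟨ cong (λ a → residue (suc a)) (toℕ-fromℕ< _) ⟩
        residue (suc a)              ≡⟨ proj₂ (proj₂ (residue-surjective (toℕ<n j))) ⟩
        toℕ j                        ∎)
        where
        open ≡-Reasoning
        a = proj₁ (residue-surjective (toℕ<n j))
      from∘to : ∀ k → from (to k) ≡ k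
      from∘to k = toℕ-injective (trans (toℕ-fromℕ< _) (residue-injective a<n (toℕ<n k)
        (trans (proj₂ (proj₂ (residue-surjective (toℕ<n (to k))))) (toℕ-fromℕ< _))))
        where a<n = proj₁ (proj₂ (residue-surjective (toℕ<n (to k))))

    -- Shifted by one so that the right-hand side involves no truncated subtraction.
    ∑-residue : ∑ n (λ p → + suc (residue p)) ≡ ∑ n (λ p → + p)
    ∑-residue = begin
      ∑ n (λ p → + suc (residue p))
        ≡⟨ ∑≡sum n (λ p → + suc (residue p)) ⟩
      Fin.sum (λ (k : Fin n) → + suc (residue (suc (toℕ k))))
        ≡⟨ Fin.sum-cong-≗ {n} (λ k → cong (λ r → + suc r) (toℕ-fromℕ< _)) ⟨
      Fin.sum (λ (k : Fin n) → + suc (toℕ (residue-permutation ⟨$⟩ʳ k)))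
        ≡⟨ Fin.sum-permute (λ k → + suc (toℕ k)) residue-permutation ⟨
      Fin.sum (λ (k : Fin n) → + suc (toℕ k))
        ≡⟨ ∑≡sum n (λ p → + p) ⟨
      ∑ n (λ p → + p) ∎
      where open ≡-Reasoning

    n*∑-quotient : + n * ∑ n quotient
                 ≡ + n * (x + + 1) - (∑ n (λ p → f (+ p)) + ∑ n (λ p → + suc (residue p)))
    n*∑-quotient = begin
      + n * ∑ n quotient
        ≡⟨ *-distribˡ-∑ n (+ n) quotient ⟨
      ∑ n (λ p → + n * quotient p)
        ≡⟨ ∑-cong n (λ p _ _ → n*quotient p) ⟩
      ∑ n (λ p → (x + + 1) - (f (+ p) + + suc (residue p)))
        ≡⟨ ∑-distrib-+ n (λ _ → x + + 1) (λ p → - (f (+ p) + + suc (residue p))) ⟩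
      ∑ n (λ _ → x + + 1) + ∑ n (λ p → - (f (+ p) + + suc (residue p)))
        ≡⟨ cong₂ _+_ (∑-const n (x + + 1)) (∑-neg n (λ p → f (+ p) + + suc (residue p))) ⟩
      + n * (x + + 1) - ∑ n (λ p → f (+ p) + + suc (residue p))
        ≡⟨ cong (λ s → + n * (x + + 1) - s) (∑-distrib-+ n (λ p → f (+ p)) (λ p → + suc (residue p))) ⟩
      + n * (x + + 1) - (∑ n (λ p → f (+ p)) + ∑ n (λ p → + suc (residue p))) ∎
      where
      open ≡-Reasoning
      n*quotient : ∀ p → + n * quotient p ≡ (x + + 1) - (f (+ p) + + suc (residue p))
      n*quotient p = sym (trans (cong (λ y → (x + + 1) - (y + + suc (residue p))) (f≡x-residue-quotient p))
                                (cancel x (+ residue p) (quotient p) (+ n)))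
        where cancel : ∀ x r q n → (x + + 1) - ((x - (r + q * n)) + (+ 1 + r)) ≡ n * q
              cancel = solve-∀

    ∑-quotient : ∑ n quotient ≡ x - + n
    ∑-quotient = *-cancelˡ-≡ (+ n) (∑ n quotient) (x - + n) (begin
      + n * ∑ n quotient                   ≡⟨ n*∑-quotient ⟩
      + n * (x + + 1) - (∑ n (λ p → f (+ p)) + ∑ n (λ p → + suc (residue p)))
        ≡⟨ cong₂ (λ s t → + n * (x + + 1) - (s + t)) (trans windowSum (sym (∑-id n))) ∑-residue ⟩
      + n * (x + + 1) - (T + T)            ≡⟨ double (+ n) x T ⟩
      + n * (x + + 1) - + 2 * T            ≡⟨ cong (λ s → + n * (x + + 1) - s) (2*∑-id n) ⟩
      + n * (x + + 1) - + n * (+ n + + 1)  ≡⟨ factor (+ n) x ⟩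
      + n * (x - + n)                      ∎)
      where
      open ≡-Reasoning
      T = ∑ n (λ p → + p)
      double : ∀ n x t → n * (x + + 1) - (t + t) ≡ n * (x + + 1) - + 2 * t
      double = solve-∀
      factor : ∀ n x → n * (x + + 1) - n * (n + + 1) ≡ n * (x - n)
      factor = solve-∀

    ∑-range-floor : ∀ {i} → i ℕ.< n → residue (suc i) ≡ 0 →
                    ∑-range (suc i) n (λ p → ⌊ f (+ p) - x / n ⌋)
                    ≡ - (∑-range (suc i) n quotient + + (n ℕ.∸ suc i))
    ∑-range-floor {i} i<n residue-i≡0 = begin
      ∑ (n ℕ.∸ suc i) (λ k → ⌊ f (+ (suc i ℕ.+ k)) - x / n ⌋)
        ≡⟨ ∑-cong (n ℕ.∸ suc i) floor-beyond ⟩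
      ∑ (n ℕ.∸ suc i) (λ k → - (quotient (suc i ℕ.+ k) + + 1))
        ≡⟨ ∑-neg (n ℕ.∸ suc i) (λ k → quotient (suc i ℕ.+ k) + + 1) ⟩
      - ∑ (n ℕ.∸ suc i) (λ k → quotient (suc i ℕ.+ k) + + 1)
        ≡⟨ cong -_ (∑-distrib-+ (n ℕ.∸ suc i) (λ k → quotient (suc i ℕ.+ k)) (λ _ → + 1)) ⟩
      - (∑-range (suc i) n quotient + ∑ (n ℕ.∸ suc i) (λ _ → + 1))
        ≡⟨ cong (λ s → - (∑-range (suc i) n quotient + s))
                (trans (∑-const (n ℕ.∸ suc i) (+ 1)) (*-identityʳ (+ (n ℕ.∸ suc i)))) ⟩
      - (∑-range (suc i) n quotient + + (n ℕ.∸ suc i)) ∎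
      where
      open ≡-Reasoning
      floor-beyond : ∀ k → 1 ≤ k → k ≤ n ℕ.∸ suc i →
                     ⌊ f (+ (suc i ℕ.+ k)) - x / n ⌋ ≡ - (quotient (suc i ℕ.+ k) + + 1)
      floor-beyond k@(suc _) _ k≤n-1-i =
        trans (cong (_/ℕ n) (swap (f (+ (suc i ℕ.+ k))) x)) (neg-/ℕ (x - f (+ (suc i ℕ.+ k))) residue≢0)
        where
        swap : ∀ y x → y - x ≡ - (x - y)
        swap = solve-∀
        i+k<n : i ℕ.+ k ℕ.< n
        i+k<n = ℕ.≤-trans (ℕ.+-monoʳ-≤ (suc i) k≤n-1-i) (ℕ.≤-reflexive (ℕ.m+[n∸m]≡n i<n))
        residue≢0 : residue (suc i ℕ.+ k) ≢ 0
        residue≢0 r≡0 = ℕ.m+1+n≢m i (residue-injective i+k<n i<n (trans r≡0 (sym residue-i≡0)))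

lemma6p8 : (n : ℕ) → .{{_ : ℕ.NonZero n}} → (f : ℤ → ℤ) → IsAffinePerm n f →
    (i : ℕ) → 1 ≤ i → i ≤ n →
    f (+ i) ≡ (+ i - ∑-range i n (λ p → ⌊ f (+ p) - f (+ i) / n ⌋))
                + ∑-range 0 (i ℕ.∸ 1) (λ p → ⌊ f (+ i) - f (+ p) / n ⌋)
lemma6p8 n f affine (suc i) _ i<n = sym (begin
  (+ suc i - ∑-range (suc i) n (λ p → ⌊ f (+ p) - x / n ⌋)) + ∑ i quotient
    ≡⟨ cong (λ s → (+ suc i - s) + ∑ i quotient) (∑-range-floor i<n residue-self) ⟩
  (+ suc i - - (∑-range (suc i) n quotient + + (n ℕ.∸ suc i))) + ∑ i quotient
    ≡⟨ regroup (+ suc i) (+ (n ℕ.∸ suc i)) (∑ i quotient) (∑-range (suc i) n quotient) ⟩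
  (+ suc i + + (n ℕ.∸ suc i)) + ((∑ i quotient + + 0) + ∑-range (suc i) n quotient)
    ≡⟨ cong₂ (λ m q → + m + ((∑ i quotient + q) + ∑-range (suc i) n quotient))
             (ℕ.m+[n∸m]≡n i<n) (sym quotient-self) ⟩
  + n + (∑ (suc i) quotient + ∑-range (suc i) n quotient)
    ≡⟨ cong (λ s → + n + s) (∑-split quotient i<n) ⟨
  + n + ∑ n quotient
    ≡⟨ cong (λ s → + n + s) ∑-quotient ⟩
  + n + (x - + n)
    ≡⟨ cancel (+ n) x ⟩
  x ∎)
  where
  open ≡-Reasoning
  x = f (+ suc i)
  open Residues affine x
  quotient-self : quotient (suc i) ≡ + 0
  quotient-self = proj₁ (divMod-unique {q = + 0} (ℕ.>-nonZero⁻¹ n) (+-inverseʳ x))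
  residue-self : residue (suc i) ≡ 0
  residue-self = proj₂ (divMod-unique {q = + 0} (ℕ.>-nonZero⁻¹ n) (+-inverseʳ x))
  regroup : ∀ a b g h → (a - - (h + b)) + g ≡ (a + b) + ((g + + 0) + h)
  regroup = solve-∀
  cancel : ∀ n x → n + (x - n) ≡ x
  cancel = solve-∀
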